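{- Let $m$ be a positive integer. If $m$ admits a $t$-squared partition, then $m\equiv 0$ or $3 \pmod 4$.
   Context: A positive integer $m$ admits a $t$-squared partition if there are positive integers $c_1,\ldots,c_t$ such that $m=b^2+2(c_1^2+\cdots+c_t^2)$ where $b=c_1+\cdots+c_t$. -}

module Defs where

open import Data.Nat using (ℕ; _+_; _*_; _<_)
open import Data.Vec using (Vec; sum; map)
open import Data.Vec.Relation.Unary.All using (All)
open import Data.Product using (Σ; _×_)
open import Relation.Binary.PropositionalEquality using (_≡_)

SquaredPartition : ℕ → ℕ → Set
SquaredPartition t m =
  Σ (Vec ℕ t) λ c →
    All (0 <_) c ×
    (m ≡ sum c * sum c + 2 * sum (map (λ x → x * x) c))

module Submission where

-- Write b = c₁ + ⋯ + c_t and s = c₁² + ⋯ + c_t², so that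
-- m = b² + 2s.  Since each cᵢ² + cᵢ = cᵢ(cᵢ + 1) is even, s + b = 2k is even,
-- hence 2s = 4k − 2b and
--     m + 2b = b² + 4k.
-- Reducing modulo 4 according to the parity of b:
--   * b = 2q:      m + 4q       = 4(q² + k),          so m ≡ 0 (mod 4);
--   * b = 2q + 1:  m + 4(q + 1) = 3 + 4(q² + q + k),  so m ≡ 3 (mod 4).

open import Defs
open import Data.Nat using (ℕ; zero; suc; _<_; _%_; _+_; _*_; NonZero)
open import Data.Nat.DivMod using ([m+kn]%n≡m%n)
open import Data.Nat.Properties using (+-assoc; *-distribˡ-+)
open import Data.Nat.Tactic.RingSolver using (solve-∀)
open import Data.Vec using (Vec; []; _∷_; sum; map)
open import Data.Product using (_,_; ∃)
open import Data.Sum using (_⊎_; inj₁; inj₂)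
open import Relation.Binary.PropositionalEquality
  using (_≡_; refl; sym; trans; cong; cong₂; module ≡-Reasoning)

open ≡-Reasoning

sumSquares : ∀ {t} → Vec ℕ t → ℕ
sumSquares c = sum (map (λ x → x * x) c)

even-or-odd : ∀ n → ∃ λ q → (n ≡ 2 * q) ⊎ (n ≡ 1 + 2 * q)
even-or-odd zero = 0 , inj₁ refl
even-or-odd (suc n) with even-or-odd n
... | q , inj₁ n≡2q   = q , inj₂ (cong suc n≡2q)
... | q , inj₂ n≡2q+1 = suc q , inj₁ (trans (cong suc n≡2q+1) (shift q))
  where
  shift : ∀ q → 2 + 2 * q ≡ 2 * suc q
  shift = solve-∀

square+self-even : ∀ x → ∃ λ k → x * x + x ≡ 2 * k
square+self-even zero = 0 , refl
square+self-even (suc x) with square+self-even x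
... | k , x²+x≡2k = k + suc x , (begin
    suc x * suc x + suc x   ≡⟨ expand x ⟩
    (x * x + x) + 2 * suc x ≡⟨ cong (_+ 2 * suc x) x²+x≡2k ⟩
    2 * k + 2 * suc x       ≡⟨ sym (*-distribˡ-+ 2 k (suc x)) ⟩
    2 * (k + suc x)         ∎)
  where
  expand : ∀ x → suc x * suc x + suc x ≡ (x * x + x) + 2 * suc x
  expand = solve-∀

sumSquares+sum-even : ∀ {t} (c : Vec ℕ t) → ∃ λ k → sumSquares c + sum c ≡ 2 * k
sumSquares+sum-even [] = 0 , refl
sumSquares+sum-even (x ∷ c) with square+self-even x | sumSquares+sum-even c
... | k , x²+x≡2k | l , s+b≡2l = k + l , (begin
    (x * x + s) + (x + b) ≡⟨ regroup (x * x) s x b ⟩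
    (x * x + x) + (s + b) ≡⟨ cong₂ _+_ x²+x≡2k s+b≡2l ⟩
    2 * k + 2 * l         ≡⟨ sym (*-distribˡ-+ 2 k l) ⟩
    2 * (k + l)           ∎)
  where
  s = sumSquares c
  b = sum c
  regroup : ∀ a s x b → (a + s) + (x + b) ≡ (a + x) + (s + b)
  regroup = solve-∀

%-cong-up-to-multiples : ∀ m r a a' n .{{_ : NonZero n}} →
  m + a * n ≡ r + a' * n → m % n ≡ r % n
%-cong-up-to-multiples m r a a' n eq = begin
  m % n            ≡⟨ sym ([m+kn]%n≡m%n m a n) ⟩
  (m + a * n) % n  ≡⟨ cong (_% n) eq ⟩
  (r + a' * n) % n ≡⟨ [m+kn]%n≡m%n r a' n ⟩
  r % n            ∎

mod4-of-shifted-square : ∀ m b k → m + 2 * b ≡ b * b + 4 * k →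
  (m % 4 ≡ 0) ⊎ (m % 4 ≡ 3)
mod4-of-shifted-square m b k eq with even-or-odd b
... | q , inj₁ refl = inj₁ (%-cong-up-to-multiples m 0 q (q * q + k) 4 (begin
    m + q * 4                 ≡⟨ cong (m +_) (double-even q) ⟩
    m + 2 * (2 * q)           ≡⟨ eq ⟩
    2 * q * (2 * q) + 4 * k   ≡⟨ square-even q k ⟩
    0 + (q * q + k) * 4       ∎))
  where
  double-even : ∀ q → q * 4 ≡ 2 * (2 * q)
  double-even = solve-∀
  square-even : ∀ q k → 2 * q * (2 * q) + 4 * k ≡ 0 + (q * q + k) * 4
  square-even = solve-∀
... | q , inj₂ refl = inj₂ (%-cong-up-to-multiples m 3 (suc q) (q * q + q + k) 4 (begin
    m + suc q * 4                           ≡⟨ cong (m +_) (double-odd q) ⟩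
    m + (2 * (1 + 2 * q) + 2)               ≡⟨ sym (+-assoc m _ 2) ⟩
    m + 2 * (1 + 2 * q) + 2                 ≡⟨ cong (_+ 2) eq ⟩
    (1 + 2 * q) * (1 + 2 * q) + 4 * k + 2   ≡⟨ square-odd q k ⟩
    3 + (q * q + q + k) * 4                 ∎))
  where
  double-odd : ∀ q → suc q * 4 ≡ 2 * (1 + 2 * q) + 2
  double-odd = solve-∀
  square-odd : ∀ q k → (1 + 2 * q) * (1 + 2 * q) + 4 * k + 2 ≡ 3 + (q * q + q + k) * 4
  square-odd = solve-∀

shifted-square : ∀ m b s k → m ≡ b * b + 2 * s → s + b ≡ 2 * k →
  m + 2 * b ≡ b * b + 4 * k
shifted-square m b s k refl s+b≡2k = begin
  b * b + 2 * s + 2 * b  ≡⟨ collect b s ⟩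
  b * b + 2 * (s + b)    ≡⟨ cong (λ z → b * b + 2 * z) s+b≡2k ⟩
  b * b + 2 * (2 * k)    ≡⟨ cong (b * b +_) (quadruple k) ⟩
  b * b + 4 * k          ∎
  where
  collect : ∀ b s → b * b + 2 * s + 2 * b ≡ b * b + 2 * (s + b)
  collect = solve-∀
  quadruple : ∀ k → 2 * (2 * k) ≡ 4 * k
  quadruple = solve-∀

lemma4p2 : (m t : ℕ) → 0 < m → SquaredPartition t m → (m % 4 ≡ 0) ⊎ (m % 4 ≡ 3)
lemma4p2 m t _ (c , _ , m≡b²+2s) with sumSquares+sum-even c
... | k , s+b≡2k =
  mod4-of-shifted-square m (sum c) k (shifted-square m (sum c) (sumSquares c) k m≡b²+2s s+b≡2k)
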